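{- Let $(s_p,s_q)$ be an implementation of a two-process architecture (as defined in the context), and let $\varphi_p$ be a local specification for process $p$. Suppose that every trace $\pi\in\mathit{Traces}(s_p,s_q)$ satisfies $\varphi_p$, i.e. $\pi{\downarrow_{O_e\cup O_p}}\models\varphi_p$. Then $(s_p,s_q)$ satisfies the information flow assumption $\psi_p$: for all $\pi,\pi'\in\mathit{Traces}(s_p,s_q)$, if $(\pi{\downarrow_{O_e}},\pi'{\downarrow_{O_e}})\in\Delta_p$ then $\pi{\downarrow_{I_p}}\neq\pi'{\downarrow_{I_p}}$.
   Context: Let $\mathcal V$ be a finite set of boolean variables. A two-process architecture is given by sets $O_p,O_q,O_e\subseteq\mathcal V$ forming a partition of $\mathcal V$ (the outputs of black-box process $p$, of black-box process $q$, and of the uncontrollable environment), together with input sets $I_p\subseteq O_q\cup O_e$ and $I_q\subseteq O_p\cup O_e$. A valuation of $V\subseteq\mathcal V$ is a subset of $V$ (the variables that are true). A trace over $V$ is an element of $(2^{V})^\omega$. For traces over disjoint sets, $x_0x_1\ldots\sqcup y_0y_1\ldots=(x_0\cup y_0)(x_1\cup y_1)\ldots$; the projection onto $V'$ is $x_0x_1\ldots{\downarrow_{V'}}=(x_0\cap V')(x_1\cap V')\ldots$. A strategy for $p$ is a function $s_p:(2^{I_p})^*\to 2^{O_p}$ (similarly $s_q:(2^{I_q})^*\to 2^{O_q}$); an implementation is a pair $(s_p,s_q)$. Their composition $s:(2^{O_e})^*\to 2^{\mathcal V}$ is given by $s(\epsilon)=s_p(\epsilon)\cup s_q(\epsilon)$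 and $s(v\cdot x)=s_p(f_p(v))\cup s_q(f_q(v))\cup x$ for $v\in(2^{O_e})^*$, $x\in 2^{O_e}$, where $f_p(\epsilon)=f_q(\epsilon)=\epsilon$, $f_p(v\cdot x)=f_p(v)\cdot((x\cup s_q(f_q(v)))\cap I_p)$ and $f_q(v\cdot x)=f_q(v)\cdot((x\cup s_p(f_p(v)))\cap I_q)$. The set $\mathit{Traces}(s_p,s_q)$ consists of all $x_0x_1x_2\ldots\in(2^{\mathcal V})^\omega$ such that there is $i_0i_1i_2\ldots\in(2^{O_e})^\omega$ with $x_k=s(i_0\ldots i_{k-1})$ for all $k\in\mathbb N$. A local specification $\varphi_p$ for $p$ is an LTL formula over atomic propositions $O_p\cup O_e$ (identified with the set of traces over $O_e\cup O_p$ satisfying it). The distinguishability relation of $p$ is $\Delta_p=\{(\pi_e,\pi_e')\in(2^{O_e})^\omega\times(2^{O_e})^\omega \mid \forall \pi_p\in(2^{O_p})^\omega:\ \text{if } \pi_e\sqcup\pi_p\models\varphi_p \text{ then } \pi_e'\sqcup\pi_p\not\models\varphi_p\}$. -}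

module Defs where

open import Data.Nat using (ℕ; zero; suc; _≤_; _<_)
open import Data.Fin using (Fin)
open import Data.Fin.Subset public
  using (Subset; _∈_; _∉_; _⊆_; _∩_; _∪_)
  renaming (⊥ to ∅; ⊤ to Full)
open import Data.List using (List; []; _∷ʳ_)
open import Data.Product using (Σ; _×_; ∃)
open import Relation.Binary.PropositionalEquality using (_≡_)
open import Relation.Nullary using (¬_)

-- Variables are Fin n; a valuation of V is a subset x ⊆ V (x : Subset n).
-- A trace over V is a map ℕ → Subset n whose values lie in V.

Trace : ℕ → Set
Trace n = ℕ → Subset n

TraceOver : ∀ {n} → Subset n → Trace n → Set
TraceOver V π = ∀ k → π k ⊆ V

_↓_ : ∀ {n} → Trace n → Subset n → Trace n
(π ↓ V) k = π k ∩ V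

_⊔_ : ∀ {n} → Trace n → Trace n → Trace n
(π ⊔ ρ) k = π k ∪ ρ k

record Architecture (n : ℕ) : Set where
  field
    Op Oq Oe Ip Iq : Subset n
    cover  : Op ∪ Oq ∪ Oe ≡ Full
    dispq  : Op ∩ Oq ≡ ∅
    dispe  : Op ∩ Oe ≡ ∅
    disqe  : Oq ∩ Oe ≡ ∅
    Ip⊆    : Ip ⊆ Oq ∪ Oe
    Iq⊆    : Iq ⊆ Op ∪ Oe

-- Implementation (s_p , s_q).  Strategies are functions on lists of subsets;
-- they are only ever applied to words over 2^{I_p} (resp. 2^{I_q}), and must
-- output valuations of O_p (resp. O_q).
record Implementation {n : ℕ} (A : Architecture n) : Set where
  open Architecture A
  field
    sp : List (Subset n) → Subset n
    sq : List (Subset n) → Subset n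
    sp⊆ : ∀ w → sp w ⊆ Op
    sq⊆ : ∀ w → sq w ⊆ Oq

module Composition {n : ℕ} {A : Architecture n} (S : Implementation A) where
  open Architecture A
  open Implementation S

  -- For an environment sequence i, fp i k = f_p(i_0 … i_{k-1}), etc.
  fp fq : (ℕ → Subset n) → ℕ → List (Subset n)
  fp i zero    = []
  fp i (suc k) = fp i k ∷ʳ ((i k ∪ sq (fq i k)) ∩ Ip)
  fq i zero    = []
  fq i (suc k) = fq i k ∷ʳ ((i k ∪ sp (fp i k)) ∩ Iq)

  -- s i k = s(i_0 … i_{k-1})
  s : (ℕ → Subset n) → ℕ → Subset n
  s i zero    = sp [] ∪ sq []
  s i (suc k) = sp (fp i k) ∪ sq (fq i k) ∪ i k

  InTraces : Trace n → Set
  InTraces π = Σ (ℕ → Subset n) λ i → TraceOver Oe i × (∀ k → π k ≡ s i k)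

data LTL (n : ℕ) : Set where
  tt    : LTL n
  atom  : Fin n → LTL n
  ¬'_   : LTL n → LTL n
  _∧'_  : LTL n → LTL n → LTL n
  X_    : LTL n → LTL n
  _U_   : LTL n → LTL n → LTL n

AtomsIn : ∀ {n} → Subset n → LTL n → Set
AtomsIn V tt = Data.Unit.⊤
  where import Data.Unit
AtomsIn V (atom a) = a ∈ V
AtomsIn V (¬' φ) = AtomsIn V φ
AtomsIn V (φ ∧' ψ) = AtomsIn V φ × AtomsIn V ψ
AtomsIn V (X φ) = AtomsIn V φ
AtomsIn V (φ U ψ) = AtomsIn V φ × AtomsIn V ψ

_,_⊨_ : ∀ {n} → Trace n → ℕ → LTL n → Set
π , k ⊨ tt = Data.Unit.⊤
  where import Data.Unit
π , k ⊨ atom a = a ∈ π k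
π , k ⊨ (¬' φ) = ¬ (π , k ⊨ φ)
π , k ⊨ (φ ∧' ψ) = (π , k ⊨ φ) × (π , k ⊨ ψ)
π , k ⊨ (X φ) = π , suc k ⊨ φ
π , k ⊨ (φ U ψ) = ∃ λ j → k ≤ j × (π , j ⊨ ψ) × (∀ m → k ≤ m → m < j → π , m ⊨ φ)

_⊨_ : ∀ {n} → Trace n → LTL n → Set
π ⊨ φ = π , 0 ⊨ φ

LocalSpec : ∀ {n} → Architecture n → Set
LocalSpec {n} A = Σ (LTL n) (AtomsIn (Architecture.Op A ∪ Architecture.Oe A))

Δp : ∀ {n} (A : Architecture n) → LTL n → Trace n → Trace n → Set
Δp A φ πe πe' =
  TraceOver (Architecture.Oe A) πe × TraceOver (Architecture.Oe A) πe' ×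
  (∀ πp → TraceOver (Architecture.Op A) πp →
     (πe ⊔ πp) ⊨ φ → ¬ ((πe' ⊔ πp) ⊨ φ))

-- If π and π' agreed on I_p, process p would have made the same observations
-- in both runs and hence produced the same outputs, so π↓O_p = π'↓O_p. Taking
-- π_p := π↓O_p, both π↓O_e ⊔ π_p = π↓(O_e ∪ O_p) and π'↓O_e ⊔ π_p = π'↓(O_e ∪ O_p)
-- satisfy φ_p, so the environment projections are not distinguishable.
module Submission where

open import Defs
open import Data.Nat using (ℕ; zero; suc; pred)
open import Data.Product using (proj₁; _,_)
open import Data.Sum using (inj₁; inj₂)
open import Data.Fin.Subset.Properties
  using (x∈p∩q⁺; x∈p∩q⁻; x∈p∪q⁻; p∩q⊆p; p∩q⊆q; ⊆-antisym; ∉⊥; Empty-unique;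
         ∪-comm; ∪-identityˡ; ∪-identityʳ; ∩-distribˡ-∪; ∩-distribʳ-∪)
open import Data.List using ([]; _∷ʳ_)
open import Function using (_∘_)
open import Relation.Binary.PropositionalEquality
  using (_≡_; _≗_; refl; sym; trans; cong; cong₂; subst; module ≡-Reasoning)
open import Relation.Nullary using (¬_)

private
  variable
    n : ℕ
    p q r : Subset n

Disjoint : Subset n → Subset n → Set
Disjoint p q = ∀ {x} → x ∈ p → x ∉ q

∩≡∅⇒Disjoint : p ∩ q ≡ ∅ → Disjoint p q
∩≡∅⇒Disjoint p∩q≡∅ x∈p x∈q = ∉⊥ (subst (_ ∈_) p∩q≡∅ (x∈p∩q⁺ (x∈p , x∈q)))

Disjoint⇒∩≡∅ : Disjoint p q → p ∩ q ≡ ∅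
Disjoint⇒∩≡∅ {p = p} {q} p#q =
  Empty-unique λ { (_ , x∈p∩q) → let x∈p , x∈q = x∈p∩q⁻ p q x∈p∩q in p#q x∈p x∈q }

Disjoint-sym : Disjoint p q → Disjoint q p
Disjoint-sym p#q x∈q x∈p = p#q x∈p x∈q

Disjoint-∪ˡ : Disjoint p r → Disjoint q r → Disjoint (p ∪ q) r
Disjoint-∪ˡ {p = p} {q = q} p#r q#r x∈p∪q with x∈p∪q⁻ p q x∈p∪q
... | inj₁ x∈p = p#r x∈p
... | inj₂ x∈q = q#r x∈q

Disjoint-⊆ˡ : p ⊆ q → Disjoint q r → Disjoint p r
Disjoint-⊆ˡ p⊆q q#r = q#r ∘ p⊆q

p⊆q⇒p∩q≡p : p ⊆ q → p ∩ q ≡ p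
p⊆q⇒p∩q≡p {p = p} {q} p⊆q = ⊆-antisym (p∩q⊆p p q) (λ x∈p → x∈p∩q⁺ (x∈p , p⊆q x∈p))

module _ {p q : Subset n} (r : Subset n) where
  open ≡-Reasoning

  ∪-∩-dropˡ : Disjoint p r → (p ∪ q) ∩ r ≡ q ∩ r
  ∪-∩-dropˡ p#r = begin
    (p ∪ q) ∩ r      ≡⟨ ∩-distribʳ-∪ r p q ⟩
    p ∩ r ∪ q ∩ r    ≡⟨ cong (_∪ q ∩ r) (Disjoint⇒∩≡∅ p#r) ⟩
    ∅ ∪ q ∩ r        ≡⟨ ∪-identityˡ (q ∩ r) ⟩
    q ∩ r            ∎

  ∪-∩-keepˡ : p ⊆ r → Disjoint q r → (p ∪ q) ∩ r ≡ p
  ∪-∩-keepˡ p⊆r q#r = begin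
    (p ∪ q) ∩ r      ≡⟨ ∩-distribʳ-∪ r p q ⟩
    p ∩ r ∪ q ∩ r    ≡⟨ cong (p ∩ r ∪_) (Disjoint⇒∩≡∅ q#r) ⟩
    p ∩ r ∪ ∅        ≡⟨ ∪-identityʳ (p ∩ r) ⟩
    p ∩ r            ≡⟨ p⊆q⇒p∩q≡p p⊆r ⟩
    p                ∎

↓-∪ : (π : Trace n) (V W : Subset n) → π ↓ (V ∪ W) ≗ (π ↓ V) ⊔ (π ↓ W)
↓-∪ π V W k = ∩-distribˡ-∪ (π k) V W

⊨-resp-≗ : {ρ ρ' : Trace n} → ρ ≗ ρ' → ∀ φ {k} → _,_⊨_ ρ k φ → _,_⊨_ ρ' k φ
⊨-resp-≗ ρ≗ρ' tt       _                      = _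
⊨-resp-≗ ρ≗ρ' (atom a) {k} a∈ρk               = subst (a ∈_) (ρ≗ρ' k) a∈ρk
⊨-resp-≗ ρ≗ρ' (¬' φ)   ρ⊭φ ρ'⊨φ               = ρ⊭φ (⊨-resp-≗ (sym ∘ ρ≗ρ') φ ρ'⊨φ)
⊨-resp-≗ ρ≗ρ' (φ ∧' ψ) (ρ⊨φ , ρ⊨ψ)            = ⊨-resp-≗ ρ≗ρ' φ ρ⊨φ , ⊨-resp-≗ ρ≗ρ' ψ ρ⊨ψ
⊨-resp-≗ ρ≗ρ' (X φ)    ρ⊨φ                    = ⊨-resp-≗ ρ≗ρ' φ ρ⊨φ
⊨-resp-≗ ρ≗ρ' (φ U ψ)  (j , k≤j , ρ⊨ψ , ρ⊨φ) =
  j , k≤j , ⊨-resp-≗ ρ≗ρ' ψ ρ⊨ψ , λ m k≤m m<j → ⊨-resp-≗ ρ≗ρ' φ (ρ⊨φ m k≤m m<j)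

module _ (A : Architecture n) where
  open Architecture A

  Oq#Op : Disjoint Oq Op
  Oq#Op = Disjoint-sym (∩≡∅⇒Disjoint dispq)

  Oe#Op : Disjoint Oe Op
  Oe#Op = Disjoint-sym (∩≡∅⇒Disjoint dispe)

  Op#Ip : Disjoint Op Ip
  Op#Ip = Disjoint-sym (Disjoint-⊆ˡ Ip⊆ (Disjoint-∪ˡ Oq#Op Oe#Op))

module _ {A : Architecture n} (S : Implementation A) where
  open Architecture A
  open Implementation S
  open Composition S

  -- fp i k is what p has observed before step k; it is the I_p-projection of the run.
  fp-suc : ∀ i k → fp i (suc k) ≡ fp i k ∷ʳ (s i (suc k) ∩ Ip)
  fp-suc i k = cong (fp i k ∷ʳ_) (sym (begin
    (sp (fp i k) ∪ sq (fq i k) ∪ i k) ∩ Ip  ≡⟨ ∪-∩-dropˡ Ip (Disjoint-⊆ˡ (sp⊆ _) (Op#Ip A)) ⟩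
    (sq (fq i k) ∪ i k) ∩ Ip                ≡⟨ cong (_∩ Ip) (∪-comm (sq (fq i k)) (i k)) ⟩
    (i k ∪ sq (fq i k)) ∩ Ip                ∎))
    where open ≡-Reasoning

  -- Both the initial output and the output at step 1 are sp [] (pred 0 = 0).
  s-∩-Op : ∀ i → TraceOver Oe i → ∀ k → s i k ∩ Op ≡ sp (fp i (pred k))
  s-∩-Op i i⊆Oe zero    = ∪-∩-keepˡ Op (sp⊆ []) (Disjoint-⊆ˡ (sq⊆ []) (Oq#Op A))
  s-∩-Op i i⊆Oe (suc k) = ∪-∩-keepˡ Op (sp⊆ (fp i k))
    (Disjoint-∪ˡ (Disjoint-⊆ˡ (sq⊆ (fq i k)) (Oq#Op A)) (Disjoint-⊆ˡ (i⊆Oe k) (Oe#Op A)))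

  fp-determined : ∀ i i' → s i ↓ Ip ≗ s i' ↓ Ip → fp i ≗ fp i'
  fp-determined i i' same zero    = refl
  fp-determined i i' same (suc k) = begin
    fp i (suc k)                         ≡⟨ fp-suc i k ⟩
    fp i k ∷ʳ (s i (suc k) ∩ Ip)         ≡⟨ cong₂ _∷ʳ_ (fp-determined i i' same k) (same (suc k)) ⟩
    fp i' k ∷ʳ (s i' (suc k) ∩ Ip)       ≡⟨ fp-suc i' k ⟨
    fp i' (suc k)                        ∎
    where open ≡-Reasoning

  ↓Op-determined-by-↓Ip : ∀ {π π'} → InTraces π → InTraces π' → π ↓ Ip ≗ π' ↓ Ip → π ↓ Op ≗ π' ↓ Op
  ↓Op-determined-by-↓Ip {π} {π'} (i , i⊆Oe , π≗si) (i' , i'⊆Oe , π'≗si') same k = begin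
    π k ∩ Op               ≡⟨ cong (_∩ Op) (π≗si k) ⟩
    s i k ∩ Op             ≡⟨ s-∩-Op i i⊆Oe k ⟩
    sp (fp i (pred k))     ≡⟨ cong sp (fp-determined i i' same-run (pred k)) ⟩
    sp (fp i' (pred k))    ≡⟨ s-∩-Op i' i'⊆Oe k ⟨
    s i' k ∩ Op            ≡⟨ cong (_∩ Op) (π'≗si' k) ⟨
    π' k ∩ Op              ∎
    where
    open ≡-Reasoning
    same-run : s i ↓ Ip ≗ s i' ↓ Ip
    same-run j = trans (cong (_∩ Ip) (sym (π≗si j))) (trans (same j) (cong (_∩ Ip) (π'≗si' j)))

theorem1 : ∀ {n} (A : Architecture n) (S : Implementation A) (φ : LocalSpec A) →
    (∀ π → Composition.InTraces S π →
      (π ↓ (Architecture.Oe A ∪ Architecture.Op A)) ⊨ proj₁ φ) →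
    ∀ π π' → Composition.InTraces S π → Composition.InTraces S π' →
      Δp A (proj₁ φ) (π ↓ Architecture.Oe A) (π' ↓ Architecture.Oe A) →
      ¬ (∀ (k : ℕ) → (π ↓ Architecture.Ip A) k ≡ (π' ↓ Architecture.Ip A) k)
theorem1 A S (φ , _) spec π π' π∈S π'∈S (_ , _ , distinguishable) same =
  distinguishable (π ↓ Op) (λ k → p∩q⊆q (π k) Op) π-sat π'-sat
  where
  open Architecture A
  π-sat : ((π ↓ Oe) ⊔ (π ↓ Op)) ⊨ φ
  π-sat = ⊨-resp-≗ (↓-∪ π Oe Op) φ (spec π π∈S)
  π'-sat : ((π' ↓ Oe) ⊔ (π ↓ Op)) ⊨ φ
  π'-sat = ⊨-resp-≗ (λ k → trans (↓-∪ π' Oe Op k)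
                                 (cong (π' k ∩ Oe ∪_) (sym (↓Op-determined-by-↓Ip S π∈S π'∈S same k))))
                    φ (spec π' π'∈S)
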